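{- Let $\sim$ be any equivalence relation on the class of equivalence structures on $\omega$ and let $M$ be an $\mathbf{Inf}\mathbf{Ex}_{\sim}$-learner. Then there is an informant locking $\mathbf{Inf}\mathbf{Ex}_{\sim}$-learner $M'$ which $\mathbf{Inf}\mathbf{Ex}_{\sim}$-learns at least all structures $\mathbf{Inf}\mathbf{Ex}_{\sim}$-learned by $M$.
   Context: An equivalence structure is $\mathcal{A}=(\omega,E)$ with $E$ an equivalence relation on $\omega$; an $\omega$-presentation of $\mathcal{M}$ is an equivalence structure with domain $\omega$ isomorphic to $\mathcal{M}$. Fix a computable sequence $(E_i)_{i\in\omega}$ of equivalence relations on $\omega$ such that every infinite computable equivalence structure is isomorphic to some $\mathcal{M}_i=(\omega,E_i)$; a conjecture $e$ denotes $\mathcal{M}_e$. An informant for $\mathcal{A}=(\omega,E)$ is $I:\omega\to\omega^2\times\{0,1\}$ such that for each $(x,y)$ exactly one of $((x,y),0),((x,y),1)$ is in the range of $I$ and $\{(x,y):((x,y),1)\in\mathrm{range}(I)\}=E$; $I[n]=I(0),\dots,I(n-1)$. A learner is an arbitrary function from finite sequences to $\omega\cup\{?\}$. $M$ $\mathbf{Inf}\mathbf{Ex}_{\sim}$-learns $\mathcal{A}$ if for every $\omega$-presentation $\mathcal{A}^*$ of $\mathcal{A}$ and every informant $I$ for $\mathcal{A}^*$ there is $e$ with $M(I[n])=e$ for all but finitely many $n$ and $\mathcal{A}^*\sim\mathcal{M}_e$. A finite sequence describes a finite part of $\mathcal{A}$ if its entries are of the form $((x,y),b)$ with $b=1$ iff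 $(x,y)\in E$. Such a $\sigma$ is a weak informant locking sequence of $M$ on $\mathcal{A}$ if $M(\tau)=M(\sigma)$ for every $\tau\supseteq\sigma$ describing a finite part of $\mathcal{A}$. $M$ is (informant) locking on $\mathcal{A}$ if for every informant $I$ for $\mathcal{A}$ there is $n$ such that $I[n]$ is a weak informant locking sequence of $M$ on $\mathcal{A}$; $M$ is informant locking if it is locking on every structure it $\mathbf{Inf}\mathbf{Ex}_{\sim}$-learns. -}

module Defs where

open import Level using (Level; _⊔_) renaming (suc to lsuc; zero to lzero)
open import Data.Nat using (ℕ; _≥_)
open import Data.Bool using (Bool; true; false)
open import Data.Maybe using (Maybe; just; nothing)
open import Data.Product using (Σ; ∃; ∃-syntax; _×_; _,_)
open import Data.Sum using (_⊎_)
open import Data.List using (List; _++_; applyUpTo)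
open import Data.List.Relation.Unary.All using (All)
open import Relation.Nullary using (¬_)
open import Relation.Binary using (Rel; IsEquivalence)
open import Relation.Binary.PropositionalEquality using (_≡_)
open import Function.Bundles using (_⇔_; _↔_; Inverse)

record EqStr : Set₁ where
  constructor eqStr
  field
    E     : ℕ → ℕ → Set
    isEqv : IsEquivalence E
open EqStr public

-- A fixed sequence (E_i) of equivalence relations on ℕ; conjecture e denotes M_e.
Enumeration : Set₁
Enumeration = ℕ → EqStr

Iso : EqStr → EqStr → Set
Iso 𝒜 ℬ = Σ (ℕ ↔ ℕ) λ f → ∀ x y →
  E 𝒜 x y ⇔ E ℬ (Inverse.to f x) (Inverse.to f y)

Presentation : EqStr → EqStr → Set
Presentation 𝒜 𝒜* = Iso 𝒜* 𝒜

-- Informant items ((x , y) , b), with b ∈ {0,1} rendered as Bool (true = 1).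
Item : Set
Item = (ℕ × ℕ) × Bool

InRange : (ℕ → Item) → Item → Set
InRange I v = ∃[ n ] (I n ≡ v)

IsInformant : (ℕ → Item) → EqStr → Set
IsInformant I 𝒜 =
  (∀ x y → (InRange I ((x , y) , false) ⊎ InRange I ((x , y) , true))
         × ¬ (InRange I ((x , y) , false) × InRange I ((x , y) , true)))
  × (∀ x y → InRange I ((x , y) , true) ⇔ E 𝒜 x y)

_[_] : (ℕ → Item) → ℕ → List Item
I [ n ] = applyUpTo I n

-- A learner: arbitrary function from finite sequences to ω ∪ {?}
-- (? rendered as nothing).
Learner : Set
Learner = List Item → Maybe ℕ

InfExLearns : Enumeration → (_∼_ : EqStr → EqStr → Set) → Learner → EqStr → Set₁
InfExLearns 𝕄 _∼_ M 𝒜 =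
  ∀ (𝒜* : EqStr) → Presentation 𝒜 𝒜* →
  ∀ (I : ℕ → Item) → IsInformant I 𝒜* →
  ∃[ e ] ((∃[ N ] ∀ n → n ≥ N → M (I [ n ]) ≡ just e) × (𝒜* ∼ 𝕄 e))

CorrectItem : EqStr → Item → Set
CorrectItem 𝒜 ((x , y) , b) = (b ≡ true) ⇔ E 𝒜 x y

Describes : EqStr → List Item → Set
Describes 𝒜 σ = All (CorrectItem 𝒜) σ

_⊑_ : List Item → List Item → Set
σ ⊑ τ = ∃[ ρ ] (τ ≡ σ ++ ρ)

WeakLockingSeq : Learner → EqStr → List Item → Set
WeakLockingSeq M 𝒜 σ =
  Describes 𝒜 σ × (∀ τ → σ ⊑ τ → Describes 𝒜 τ → M τ ≡ M σ)

LockingOn : Learner → EqStr → Set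
LockingOn M 𝒜 = ∀ (I : ℕ → Item) → IsInformant I 𝒜 → ∃[ n ] WeakLockingSeq M 𝒜 (I [ n ])

InformantLocking : Enumeration → (EqStr → EqStr → Set) → Learner → Set₁
InformantLocking 𝕄 _∼_ M = ∀ (𝒜 : EqStr) → InfExLearns 𝕄 _∼_ M 𝒜 → LockingOn M 𝒜

-- On σ the learner M′ runs M on the longest prefix of the canonical informant
-- (all pairs in a fixed enumeration, each with its bit) that σ determines, so
-- M′ is blind to the order of presentation.  If M learns 𝒜, then M converges,
-- say to e from stage N on, on the canonical informant of every presentation.
-- Once σ determines the first N pairs, M′ turns every correct extension of σ
-- into a canonical prefix of length ≥ N, hence outputs e on all of them: M′
-- learns 𝒜 and σ is a locking sequence.  Locking is required for structures
-- learned by M′ rather than M; these are handled the same way because M′ and M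
-- agree on canonical prefixes.
module Submission where

open import Defs
open import Data.Product using (Σ; _×_)
open import Relation.Binary using (IsEquivalence)

open import Relation.Binary.Definitions using (DecidableEquality)
open import Data.Product using (_,_; proj₁; proj₂; ∃-syntax)
open import Data.Product.Properties using (≡-dec)
open import Data.Nat using (ℕ; zero; suc; _+_; _≤_; _<_; _≥_; _⊔_; z≤n; s≤s; _≟_)
open import Data.Nat.Properties
  using (+-suc; +-identityʳ; suc-injective; ≤-refl; ≤-trans; ≤-antisym; m≤m⊔n; m≤n⊔m; m≤m+n; n<1+n; n≤1+n;
         m<1+n⇒m<n∨m≡n)
open import Data.Bool using (Bool; true; false)
open import Data.Maybe using (Maybe; just; nothing; Is-just)
open import Data.Maybe.Properties using (just-injective)
open import Data.Maybe.Relation.Unary.Any using (just)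
open import Data.Unit using (tt)
open import Data.Sum using (_⊎_; inj₁; inj₂)
open import Data.Empty using (⊥-elim)
open import Data.List using (List; []; _∷_; _++_; applyUpTo; length)
open import Data.List.Properties using (length-applyUpTo; length-++; ++-identityʳ)
import Data.List.Relation.Unary.All as All
open import Data.List.Relation.Unary.Any using (here; there)
open import Data.List.Membership.Propositional using (_∈_)
open import Data.List.Membership.Propositional.Properties using (∈-applyUpTo⁺; ∈-applyUpTo⁻)
open import Function using (_∘_)
open import Function.Bundles using (Equivalence; mk⇔)
open import Function.Construct.Identity using (↔-id; ⇔-id)
open import Relation.Nullary using (¬_; yes; no; contradiction)
open import Relation.Binary.PropositionalEquality
  using (_≡_; refl; sym; trans; cong; cong₂; subst; module ≡-Reasoning)

next : ℕ × ℕ → ℕ × ℕ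
next (x , zero)  = 0 , suc x
next (x , suc y) = suc x , y

-- Enumerates ℕ × ℕ antidiagonal by antidiagonal.
unpair : ℕ → ℕ × ℕ
unpair zero    = 0 , 0
unpair (suc k) = next (unpair k)

unpair-surjective : ∀ p → ∃[ k ] unpair k ≡ p
unpair-surjective (x , y) = reach (x + y) x y refl
  where
  reach : ∀ s x y → x + y ≡ s → ∃[ k ] unpair k ≡ (x , y)
  reach zero    zero    zero    _  = 0 , refl
  reach zero    zero    (suc y) ()
  reach (suc s) zero    zero    ()
  reach (suc s) zero    (suc y) eq with k , e ← reach s y 0 (trans (+-identityʳ y) (suc-injective eq)) =
    suc k , cong next e
  reach s       (suc x) y       eq with k , e ← reach s x (suc y) (trans (+-suc x y) eq) =
    suc k , cong next e

applyUpTo-⊑ : ∀ (f : ℕ → Item) {n n′} → n ≤ n′ → applyUpTo f n ⊑ applyUpTo f n′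
applyUpTo-⊑ f {n′ = n′} z≤n = applyUpTo f n′ , refl
applyUpTo-⊑ f (s≤s n≤n′) with ρ , e ← applyUpTo-⊑ (f ∘ suc) n≤n′ = ρ , cong (f 0 ∷_) e

⊑-refl : ∀ σ → σ ⊑ σ
⊑-refl σ = [] , sym (++-identityʳ σ)

commonBound : (P : ℕ → ℕ → Set) → (∀ {i n n′} → n ≤ n′ → P i n → P i n′) →
  (∀ i → ∃[ n ] P i n) → ∀ N → ∃[ n ] (N ≤ n × (∀ i → i < N → P i n))
commonBound P mono witness zero = 0 , z≤n , λ _ ()
commonBound P mono witness (suc N)
  with n , N≤n , below ← commonBound P mono witness N | m , atN ← witness N =
  suc (n ⊔ m) , s≤s (≤-trans N≤n (m≤m⊔n n m)) , below′
  where
  below′ : ∀ i → i < suc N → P i (suc (n ⊔ m))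
  below′ i i<1+N with m<1+n⇒m<n∨m≡n i<1+N
  ... | inj₁ i<N  = mono (≤-trans (m≤m⊔n n m) (n≤1+n _)) (below i i<N)
  ... | inj₂ refl = mono (≤-trans (m≤n⊔m n m) (n≤1+n _)) atN

_≟₂_ : DecidableEquality (ℕ × ℕ)
_≟₂_ = ≡-dec _≟_ _≟_

known : List Item → ℕ × ℕ → Maybe Bool
known [] p = nothing
known ((q , b) ∷ σ) p with q ≟₂ p
... | yes _ = just b
... | no _  = known σ p

known-sound : ∀ σ {p b} → known σ p ≡ just b → (p , b) ∈ σ
known-sound ((q , c) ∷ σ) {p} eq with q ≟₂ p
... | yes refl = here (cong (p ,_) (sym (just-injective eq)))
... | no _     = there (known-sound σ eq)

∈⇒known : ∀ σ {p b} → (p , b) ∈ σ → Is-just (known σ p)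
∈⇒known ((q , c) ∷ σ) {p} p∈σ with q ≟₂ p
∈⇒known ((q , c) ∷ σ) _          | yes _   = just tt
∈⇒known ((q , c) ∷ σ) (here refl) | no q≢q = contradiction refl q≢q
∈⇒known ((q , c) ∷ σ) (there p∈σ) | no _   = ∈⇒known σ p∈σ

known-++⁺ : ∀ σ ρ {p} → Is-just (known σ p) → Is-just (known (σ ++ ρ) p)
known-++⁺ ((q , c) ∷ σ) ρ {p} isJust with q ≟₂ p
... | yes _ = isJust
... | no _  = known-++⁺ σ ρ isJust

reconstructFrom : (ℕ × ℕ → Maybe Bool) → (ℕ → ℕ × ℕ) → ℕ → List Item
reconstructFrom κ g zero = []
reconstructFrom κ g (suc f) with κ (g 0)
... | nothing = []
... | just b  = (g 0 , b) ∷ reconstructFrom κ (g ∘ suc) f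

module _ {κ : ℕ × ℕ → Maybe Bool} where

  reconstructFrom-≡-applyUpTo : (χ : ℕ × ℕ → Bool) → (∀ p {b} → κ p ≡ just b → b ≡ χ p) →
    ∀ g f → reconstructFrom κ g f ≡ applyUpTo (λ i → g i , χ (g i)) (length (reconstructFrom κ g f))
  reconstructFrom-≡-applyUpTo χ κ⊆χ g zero = refl
  reconstructFrom-≡-applyUpTo χ κ⊆χ g (suc f) with κ (g 0) in eq
  ... | nothing = refl
  ... | just _  = cong₂ _∷_ (cong (g 0 ,_) (κ⊆χ (g 0) eq)) (reconstructFrom-≡-applyUpTo χ κ⊆χ (g ∘ suc) f)

  length-reconstructFrom-mono : ∀ {κ′} → (∀ p → Is-just (κ p) → Is-just (κ′ p)) →
    ∀ g {f f′} → f ≤ f′ → length (reconstructFrom κ g f) ≤ length (reconstructFrom κ′ g f′)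
  length-reconstructFrom-mono κ⊆κ′ g z≤n = z≤n
  length-reconstructFrom-mono {κ′} κ⊆κ′ g {suc f} (s≤s f≤f′) with κ (g 0) in eq
  ... | nothing = z≤n
  ... | just _ with κ′ (g 0) | κ⊆κ′ (g 0) (subst Is-just (sym eq) (just tt))
  ...   | just _ | _ = s≤s (length-reconstructFrom-mono κ⊆κ′ (g ∘ suc) f≤f′)

  length-reconstructFrom-≥ : ∀ g {N f} → (∀ i → i < N → Is-just (κ (g i))) → N ≤ f →
    N ≤ length (reconstructFrom κ g f)
  length-reconstructFrom-≥ g all-known z≤n = z≤n
  length-reconstructFrom-≥ g {suc N} {suc f} all-known (s≤s N≤f) with κ (g 0) | all-known 0 (s≤s z≤n)
  ... | just _ | _ = s≤s (length-reconstructFrom-≥ (g ∘ suc) (λ i i<N → all-known (suc i) (s≤s i<N)) N≤f)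

  length-reconstructFrom-≤ : ∀ g f → length (reconstructFrom κ g f) ≤ f
  length-reconstructFrom-≤ g zero = z≤n
  length-reconstructFrom-≤ g (suc f) with κ (g 0)
  ... | nothing = z≤n
  ... | just _  = s≤s (length-reconstructFrom-≤ (g ∘ suc) f)

reconstruct : List Item → List Item
reconstruct σ = reconstructFrom (known σ) unpair (length σ)

lockingLearner : Learner → Learner
lockingLearner M σ = M (reconstruct σ)

length-reconstruct-⊑ : ∀ {σ τ} → σ ⊑ τ → length (reconstruct σ) ≤ length (reconstruct τ)
length-reconstruct-⊑ {σ} (ρ , refl) =
  length-reconstructFrom-mono (λ _ → known-++⁺ σ ρ) unpair
    (subst (length σ ≤_) (sym (length-++ σ)) (m≤m+n (length σ) (length ρ)))

Characteristic : EqStr → (ℕ × ℕ → Bool) → Set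
Characteristic 𝒜 χ = ∀ p → CorrectItem 𝒜 (p , χ p)

CorrectItem-unique : ∀ {𝒜 p b c} → CorrectItem 𝒜 (p , b) → CorrectItem 𝒜 (p , c) → b ≡ c
CorrectItem-unique {b = true}  {true}  _  _  = refl
CorrectItem-unique {b = false} {false} _  _  = refl
CorrectItem-unique {b = true}  {false} cb cc = sym (Equivalence.from cc (Equivalence.to cb refl))
CorrectItem-unique {b = false} {true}  cb cc = Equivalence.from cb (Equivalence.to cc refl)

known-characteristic : ∀ {𝒜 χ σ} → Characteristic 𝒜 χ → Describes 𝒜 σ →
  ∀ p {b} → known σ p ≡ just b → b ≡ χ p
known-characteristic {𝒜} {χ} {σ} χ-char σ-correct p eq =
  CorrectItem-unique {𝒜} (All.lookup σ-correct (known-sound σ eq)) (χ-char p)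

canonicalInformant : (ℕ × ℕ → Bool) → ℕ → Item
canonicalInformant χ k = unpair k , χ (unpair k)

module _ {χ : ℕ × ℕ → Bool} where

  private
    C = canonicalInformant χ

  canonicalInformant-complete : ∀ p → InRange C (p , χ p)
  canonicalInformant-complete p with k , refl ← unpair-surjective p = k , refl

  canonicalInformant-sound : ∀ {p b} → InRange C (p , b) → χ p ≡ b
  canonicalInformant-sound (k , refl) = refl

  canonicalInformant-isInformant : ∀ {𝒜} → Characteristic 𝒜 χ → IsInformant C 𝒜
  canonicalInformant-isInformant χ-char =
    (λ x y → total (x , y) , exclusive) ,
    λ x y → mk⇔ (Equivalence.to (χ-char (x , y)) ∘ canonicalInformant-sound)
                (λ e → subst (λ b → InRange C ((x , y) , b)) (Equivalence.from (χ-char (x , y)) e)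
                             (canonicalInformant-complete (x , y)))
    where
    total : ∀ p → InRange C (p , false) ⊎ InRange C (p , true)
    total p with χ p | canonicalInformant-complete p
    ... | false | r = inj₁ r
    ... | true  | r = inj₂ r
    exclusive : ∀ {p} → ¬ (InRange C (p , false) × InRange C (p , true))
    exclusive (r₀ , r₁) with trans (sym (canonicalInformant-sound r₀)) (canonicalInformant-sound r₁)
    ... | ()

  reconstruct-canonical : ∀ {𝒜 σ} → Characteristic 𝒜 χ → Describes 𝒜 σ →
    reconstruct σ ≡ C [ length (reconstruct σ) ]
  reconstruct-canonical {𝒜} {σ} χ-char σ-correct =
    reconstructFrom-≡-applyUpTo χ (known-characteristic {𝒜} χ-char σ-correct) unpair (length σ)

  reconstruct-canonicalPrefix : ∀ k → reconstruct (C [ k ]) ≡ C [ k ]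
  reconstruct-canonicalPrefix k = begin
    reconstruct (C [ k ])
      ≡⟨ reconstructFrom-≡-applyUpTo χ known-canonical unpair (length (C [ k ])) ⟩
    C [ length (reconstruct (C [ k ])) ]
      ≡⟨ cong (C [_]) length-reconstruct ⟩
    C [ k ]
      ∎
    where
    open ≡-Reasoning
    ∣C[k]∣≡k : length (C [ k ]) ≡ k
    ∣C[k]∣≡k = length-applyUpTo C k
    known-canonical : ∀ p {b} → known (C [ k ]) p ≡ just b → b ≡ χ p
    known-canonical p eq with i , _ , pb≡Ci ← ∈-applyUpTo⁻ C (known-sound (C [ k ]) eq) =
      sym (canonicalInformant-sound (i , sym pb≡Ci))
    length-reconstruct : length (reconstruct (C [ k ])) ≡ k
    length-reconstruct = ≤-antisym
      (subst (length (reconstruct (C [ k ])) ≤_) ∣C[k]∣≡k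
        (length-reconstructFrom-≤ unpair (length (C [ k ]))))
      (length-reconstructFrom-≥ unpair (λ i i<k → ∈⇒known (C [ k ]) (∈-applyUpTo⁺ C i<k))
        (subst (k ≤_) (sym ∣C[k]∣≡k) ≤-refl))

  lockingLearner-constant : ∀ {𝒜} (M : Learner) {e N σ} → Characteristic 𝒜 χ →
    (∀ k → k ≥ N → M (C [ k ]) ≡ just e) →
    (∀ i → i < N → Is-just (known σ (unpair i))) → N ≤ length σ →
    ∀ τ → σ ⊑ τ → Describes 𝒜 τ → lockingLearner M τ ≡ just e
  lockingLearner-constant {𝒜} M {e} {N} χ-char converges σ-knows N≤∣σ∣ τ σ⊑τ τ-correct = begin
    M (reconstruct τ)                  ≡⟨ cong M (reconstruct-canonical {𝒜} χ-char τ-correct) ⟩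
    M (C [ length (reconstruct τ) ])   ≡⟨ converges _ N≤∣τ̂∣ ⟩
    just e                             ∎
    where
    open ≡-Reasoning
    N≤∣τ̂∣ : N ≤ length (reconstruct τ)
    N≤∣τ̂∣ = ≤-trans (length-reconstructFrom-≥ unpair σ-knows N≤∣σ∣) (length-reconstruct-⊑ σ⊑τ)

module Informant (𝒜 : EqStr) {J : ℕ → Item} (J-informant : IsInformant J 𝒜) where

  inRange-correct : ∀ {p b} → InRange J (p , b) → CorrectItem 𝒜 (p , b)
  inRange-correct {x , y} {true} r = mk⇔ (λ _ → Equivalence.to (proj₂ J-informant x y) r) (λ _ → refl)
  inRange-correct {x , y} {false} r = mk⇔ (λ ()) λ e →
    ⊥-elim (proj₂ (proj₁ J-informant x y) (r , Equivalence.from (proj₂ J-informant x y) e))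

  prefix-describes : ∀ n → Describes 𝒜 (J [ n ])
  prefix-describes n = All.tabulate λ v∈J[n] →
    let i , _ , v≡Ji = ∈-applyUpTo⁻ J v∈J[n] in subst (CorrectItem 𝒜) (sym v≡Ji) (inRange-correct (i , refl))

  occurs : ∀ p → ∃[ b ] InRange J (p , b)
  occurs (x , y) with proj₁ (proj₁ J-informant x y)
  ... | inj₁ r = false , r
  ... | inj₂ r = true , r

  bit : ℕ × ℕ → Bool
  bit p = proj₁ (occurs p)

  bit-characteristic : Characteristic 𝒜 bit
  bit-characteristic p = inRange-correct (proj₂ (occurs p))

  eventually-known : ∀ p → ∃[ n ] Is-just (known (J [ n ]) p)
  eventually-known p with _ , m , Jm≡pb ← occurs p =
    suc m , ∈⇒known (J [ suc m ]) (subst (_∈ J [ suc m ]) Jm≡pb (∈-applyUpTo⁺ J (n<1+n m)))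

  known-mono : ∀ {p n n′} → n ≤ n′ → Is-just (known (J [ n ]) p) → Is-just (known (J [ n′ ]) p)
  known-mono {p} {n} n≤n′ isJust with ρ , J[n′]≡J[n]++ρ ← applyUpTo-⊑ J n≤n′ =
    subst (λ σ → Is-just (known σ p)) (sym J[n′]≡J[n]++ρ) (known-++⁺ (J [ n ]) ρ isJust)

  lockingLearner-locks : ∀ (M : Learner) {χ e N} → Characteristic 𝒜 χ →
    (∀ k → k ≥ N → M (canonicalInformant χ [ k ]) ≡ just e) →
    ∃[ n ] ∀ τ → (J [ n ]) ⊑ τ → Describes 𝒜 τ → lockingLearner M τ ≡ just e
  lockingLearner-locks M {N = N} χ-char converges
    with n , N≤n , J[n]-knows ← commonBound (λ i n → Is-just (known (J [ n ]) (unpair i)))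
                                  known-mono (eventually-known ∘ unpair) N =
    n , lockingLearner-constant {𝒜 = 𝒜} M χ-char converges J[n]-knows
          (subst (N ≤_) (sym (length-applyUpTo J n)) N≤n)

  lockingLearner-stabilises : ∀ (𝕄 : Enumeration) (_∼_ : EqStr → EqStr → Set) (M L : Learner) →
    (∀ χ k → L (canonicalInformant χ [ k ]) ≡ M (canonicalInformant χ [ k ])) →
    ∀ ℬ → InfExLearns 𝕄 _∼_ L ℬ → Presentation ℬ 𝒜 →
    ∃[ e ] (∃[ n ] (∀ τ → (J [ n ]) ⊑ τ → Describes 𝒜 τ → lockingLearner M τ ≡ just e)) × 𝒜 ∼ 𝕄 e
  lockingLearner-stabilises 𝕄 _∼_ M L L≗M _ L-learns presentation
    with e , (N , converges) , 𝒜∼𝕄e ← L-learns 𝒜 presentation (canonicalInformant bit)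
                                       (canonicalInformant-isInformant {𝒜 = 𝒜} bit-characteristic) =
    e , lockingLearner-locks M bit-characteristic (λ k k≥N → trans (sym (L≗M bit k)) (converges k k≥N)) , 𝒜∼𝕄e

identityPresentation : ∀ 𝒜 → Presentation 𝒜 𝒜
identityPresentation 𝒜 = ↔-id ℕ , λ _ _ → ⇔-id _

mainTheorem11 : (𝕄 : Enumeration) (_∼_ : EqStr → EqStr → Set) → IsEquivalence _∼_ →
    (M : Learner) →
    Σ Learner (λ M' → InformantLocking 𝕄 _∼_ M' ×
      (∀ (𝒜 : EqStr) → InfExLearns 𝕄 _∼_ M 𝒜 → InfExLearns 𝕄 _∼_ M' 𝒜))
mainTheorem11 𝕄 _∼_ _ M = lockingLearner M , locking , learns
  where
  locking : InformantLocking 𝕄 _∼_ (lockingLearner M)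
  locking 𝒜 M′-learns J J-informant
    with e , (n , constant) , _ ←
           Informant.lockingLearner-stabilises 𝒜 J-informant 𝕄 _∼_ M (lockingLearner M)
             (λ χ k → cong M (reconstruct-canonicalPrefix {χ} k)) 𝒜 M′-learns (identityPresentation 𝒜) =
    n , J[n]-correct , λ τ J[n]⊑τ τ-correct →
      trans (constant τ J[n]⊑τ τ-correct) (sym (constant (J [ n ]) (⊑-refl (J [ n ])) J[n]-correct))
    where
    J[n]-correct : Describes 𝒜 (J [ n ])
    J[n]-correct = Informant.prefix-describes 𝒜 J-informant n

  learns : ∀ 𝒜 → InfExLearns 𝕄 _∼_ M 𝒜 → InfExLearns 𝕄 _∼_ (lockingLearner M) 𝒜
  learns 𝒜 M-learns 𝒜* presentation J J-informant
    with e , (n , constant) , 𝒜*∼𝕄e ←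
           Informant.lockingLearner-stabilises 𝒜* J-informant 𝕄 _∼_ M M (λ _ _ → refl) 𝒜 M-learns presentation =
    e , (n , λ m n≤m → constant (J [ m ]) (applyUpTo-⊑ J n≤m) (Informant.prefix-describes 𝒜* J-informant m)) ,
    𝒜*∼𝕄e
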